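{- Let $G$ be a 3-regular graph. Then $\overrightarrow{\chi_{u}}(G)=4$ if and only if $G$ belongs to Class 1. Moreover, if $G$ is a 4-regular graph, then $\overrightarrow{\chi_{u}}(G)=7$ if and only if $G$ belongs to Class 1.
   Context: All graphs are finite and simple. For a positive integer $k$, $\mathbb{N}_k=\{1,2,\ldots,k\}$. A universal labeling of a graph $G$ is a function $\ell: E(G)\to \mathbb{N}_k$ such that for every orientation of the edges of $G$ and every edge $uv\in E(G)$, the sum of $\ell(e)$ over the edges $e$ oriented into $u$ differs from the sum of $\ell(e)$ over the edges $e$ oriented into $v$. The universal labeling number $\overrightarrow{\chi_{u}}(G)$ is the minimum $k$ such that $G$ has a universal labeling with labels from $\mathbb{N}_k$. A graph $G$ belongs to Class 1 if its chromatic index (the least number of colors in a proper edge coloring) equals its maximum degree $\Delta(G)$. -}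

module Defs where

open import Data.Nat using (ℕ; zero; suc; _+_; _≤_; _∸_)
open import Data.Bool using (Bool; true; false; if_then_else_)
open import Data.Fin using (Fin)
open import Data.List using (List; map; allFin)
open import Data.Nat.ListAction using (sum)
open import Data.Product using (Σ; _×_; _,_; ∃)
open import Data.Sum using (_⊎_)
open import Relation.Nullary using (¬_)
open import Relation.Binary.PropositionalEquality using (_≡_; _≢_)

record Graph : Set where
  field
    n      : ℕ
    adj    : Fin n → Fin n → Bool
    sym    : ∀ u v → adj u v ≡ adj v u
    irrefl : ∀ v → adj v v ≡ false

open Graph public

Σv : (G : Graph) → (Fin (n G) → ℕ) → ℕ
Σv G f = sum (map f (allFin (n G)))

degree : (G : Graph) → Fin (n G) → ℕ
degree G v = Σv G (λ w → if adj G v w then 1 else 0)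

Regular : ℕ → Graph → Set
Regular d G = ∀ v → degree G v ≡ d

Edge : (G : Graph) → Fin (n G) → Fin (n G) → Set
Edge G u v = adj G u v ≡ true

MaxDegree : (G : Graph) → ℕ → Set
MaxDegree G d = (∃ λ v → degree G v ≡ d) × (∀ v → degree G v ≤ d)

-- Edge labelings/colorings are functions on ordered pairs of vertices that
-- are symmetric on edges; values on non-edges are irrelevant.

ProperEdgeColoring : (G : Graph) → (k : ℕ) → (Fin (n G) → Fin (n G) → Fin k) → Set
ProperEdgeColoring G k c =
  (∀ u v → Edge G u v → c u v ≡ c v u) ×
  (∀ u v w → Edge G u v → Edge G u w → v ≢ w → c u v ≢ c u w)

EdgeColorable : Graph → ℕ → Set
EdgeColorable G k = Σ (Fin (n G) → Fin (n G) → Fin k) (ProperEdgeColoring G k)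

ChromaticIndex : Graph → ℕ → Set
ChromaticIndex G k = EdgeColorable G k × (∀ j → EdgeColorable G j → k ≤ j)

Class1 : Graph → Set
Class1 G = Σ ℕ λ d → MaxDegree G d × ChromaticIndex G d

-- An orientation: o u v = true means the edge uv is oriented from u into v.
-- Every edge receives exactly one direction.
Orientation : (G : Graph) → (Fin (n G) → Fin (n G) → Bool) → Set
Orientation G o = ∀ u v → Edge G u v →
  (o u v ≡ true × o v u ≡ false) ⊎ (o u v ≡ false × o v u ≡ true)

inSum : (G : Graph) → (Fin (n G) → Fin (n G) → ℕ) →
        (Fin (n G) → Fin (n G) → Bool) → Fin (n G) → ℕ
inSum G ℓ o v = Σv G (λ w → if adj G w v then (if o w v then ℓ w v else 0) else 0)

Labeling : (G : Graph) → ℕ → (Fin (n G) → Fin (n G) → ℕ) → Set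
Labeling G k ℓ = ∀ u v → Edge G u v → (ℓ u v ≡ ℓ v u) × (1 ≤ ℓ u v) × (ℓ u v ≤ k)

UniversalLabeling : (G : Graph) → ℕ → (Fin (n G) → Fin (n G) → ℕ) → Set
UniversalLabeling G k ℓ = Labeling G k ℓ ×
  (∀ o → Orientation G o → ∀ u v → Edge G u v → inSum G ℓ o u ≢ inSum G ℓ o v)

HasUniversalLabeling : Graph → ℕ → Set
HasUniversalLabeling G k = Σ (Fin (n G) → Fin (n G) → ℕ) (UniversalLabeling G k)

UnivLabelingNumber : Graph → ℕ → Set
UnivLabelingNumber G k = HasUniversalLabeling G k × (∀ j → HasUniversalLabeling G j → k ≤ j)

module Submission where

open import Defs renaming (sym to adj-sym)
open import Data.Product using (_×_)
open import Function.Bundles using (_⇔_; mk⇔)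

open import Algebra.Properties.CommutativeSemigroup using (x∙yz≈y∙xz)
open import Data.Bool using (Bool; true; false; if_then_else_; not; T)
open import Data.Bool.ListAction using (any)
import Data.Bool.Properties as Bool
open import Data.Fin using (Fin)
import Data.Fin as Fin
import Data.Fin.Properties as Fin
open import Data.List
  using (List; []; _∷_; [_]; _++_; map; length; filter; lookup; applyUpTo; cartesianProductWith; allFin)
open import Data.List.Membership.Propositional using (_∈_; _∉_; find)
open import Data.List.Membership.Propositional.Properties
  using (∈-map⁺; ∈-map⁻; ∈-++⁺ˡ; ∈-++⁺ʳ; ∈-++⁻; ∈-filter⁺; ∈-filter⁻; ∈-applyUpTo⁺;
         ∈-cartesianProductWith⁺; ∈-allFin; ∈-lookup)
open import Data.List.Properties using (length-map; filter-all; filter-reject; filter-accept; map-cong-local; map-∘)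
open import Data.List.Relation.Unary.All as All using (All; []; _∷_; all?)
import Data.List.Relation.Unary.All.Properties as Allₚ
open import Data.List.Relation.Unary.AllPairs using (AllPairs; []; _∷_; allPairs?)
import Data.List.Relation.Unary.AllPairs.Properties as AllPairsₚ
open import Data.List.Relation.Unary.Any as Any using (Any; here; there; any?)
import Data.List.Relation.Unary.Any.Properties as Anyₚ
open import Data.List.Relation.Unary.Unique.Propositional using (Unique)
import Data.List.Relation.Unary.Unique.Propositional.Properties as Uniqueₚ
open import Data.Nat using (ℕ; zero; suc; _+_; _≡ᵇ_; _≤_; _≤?_; s≤s; z≤n; NonZero; >-nonZero⁻¹)
open import Data.Nat.ListAction using (sum)
open import Data.Nat.Properties
  using (+-identityʳ; +-commutativeSemigroup; ≡ᵇ⇒≡; ≡⇒≡ᵇ; ≤-trans; ≤-reflexive; ≰⇒≥)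
  renaming (_≟_ to _≟ℕ_)
open import Data.List.Membership.DecPropositional _≟ℕ_ using (_∈?_)
open import Data.List.Relation.Unary.Unique.DecPropositional _≟ℕ_ using (unique?)
open import Data.Product using (_,_; ∃; map₂; proj₁; proj₂)
open import Data.Sum using (_⊎_; inj₁; inj₂)
open import Function using (_∘_)
open import Relation.Binary using (tri<; tri≈; tri>)
open import Relation.Binary.Definitions using (DecidableEquality)
open import Relation.Binary.PropositionalEquality
  using (_≡_; _≢_; refl; sym; trans; cong; cong₂; subst; module ≡-Reasoning)
open import Relation.Nullary using (Dec; does; yes; no; ¬_; ¬?; contradiction; _×-dec_; _⊎-dec_; _→-dec_)
open import Relation.Nullary.Decidable using (T?; map′; dec-true; dec-false; from-yes)
open import Relation.Unary using (Decidable)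

-- A labeling ℓ is universal iff along every edge uv no sum of labels of a set of other edges at u
-- equals ℓ(uv) plus a sum of labels of other edges at v: orient uv into v, and the other edges at u
-- and at v into their endpoint exactly when they belong to the two sets. In particular the labels
-- around a vertex are sum-free, so the question becomes local and finite. For (d, K) = (3, 4) and
-- (4, 7) an exhaustive search shows that every sum-free d-tuple of labels ≤ K either contains K and
-- is mapped injectively into d colours by a fixed map, or cannot sit at an endpoint of an edge; so a
-- universal labeling with labels ≤ K is a proper d-edge-colouring in disguise and uses the label K.
-- Conversely, relabelling the colour classes of a proper d-edge-colouring by {1, 2, 4}, resp.
-- {3, 5, 6, 7}, separates every edge.

-- Subset sums and separated edges

selectedSum : {A : Set} → (A → Bool) → (A → ℕ) → List A → ℕ
selectedSum p f xs = sum (map (λ x → if p x then f x else 0) xs)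

selectedSum-cong : ∀ {A : Set} {p q : A → Bool} {f g : A → ℕ} {xs} →
  (∀ {x} → x ∈ xs → p x ≡ q x) → (∀ {x} → x ∈ xs → f x ≡ g x) → selectedSum p f xs ≡ selectedSum q g xs
selectedSum-cong p≗q f≗g =
  cong sum (map-cong-local (All.tabulate λ x∈ → cong₂ (λ b y → if b then y else 0) (p≗q x∈) (f≗g x∈)))

selectedSum-filter : ∀ {A : Set} (p : A → Bool) f xs →
  selectedSum p f xs ≡ sum (map f (filter (λ x → p x Bool.≟ true) xs))
selectedSum-filter p f []       = refl
selectedSum-filter p f (x ∷ xs) with p x
... | false = selectedSum-filter p f xs
... | true  = cong (f x +_) (selectedSum-filter p f xs)

subsetSums : List ℕ → List ℕ
subsetSums []       = [ 0 ]
subsetSums (x ∷ xs) = subsetSums xs ++ map (x +_) (subsetSums xs)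

0∈subsetSums : ∀ xs → 0 ∈ subsetSums xs
0∈subsetSums []       = here refl
0∈subsetSums (x ∷ xs) = ∈-++⁺ˡ (0∈subsetSums xs)

selectedSum∈subsetSums : ∀ {A : Set} (p : A → Bool) f xs → selectedSum p f xs ∈ subsetSums (map f xs)
selectedSum∈subsetSums p f []       = here refl
selectedSum∈subsetSums p f (x ∷ xs) with p x
... | false = ∈-++⁺ˡ (selectedSum∈subsetSums p f xs)
... | true  = ∈-++⁺ʳ (subsetSums (map f xs)) (∈-map⁺ (f x +_) (selectedSum∈subsetSums p f xs))

-- Membership of naturals is decided through _≡ᵇ_ directly: going through _≟_ and any? makes the
-- exhaustive checks below several times slower.
_∉?_ : ∀ x ys → Dec (x ∉ ys)
x ∉? ys = map′ absent present (T? (not (any (x ≡ᵇ_) ys)))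
  where
  absent : T (not (any (x ≡ᵇ_) ys)) → x ∉ ys
  absent none x∈ with any (x ≡ᵇ_) ys | Anyₚ.any⁺ (x ≡ᵇ_) (Any.map (λ {y} → ≡⇒≡ᵇ x y) x∈)
  ... | true  | _  = none
  ... | false | ()
  present : x ∉ ys → T (not (any (x ≡ᵇ_) ys))
  present x∉ with any (x ≡ᵇ_) ys in found
  ... | false = _
  ... | true  = x∉ (Any.map (λ {y} → ≡ᵇ⇒≡ x y) (Anyₚ.any⁻ (x ≡ᵇ_) ys (subst T (sym found) _)))

Separated : ℕ → List ℕ → List ℕ → Set
Separated x X Y = All (_∉ map (x +_) (subsetSums Y)) (subsetSums X)

separated? : ∀ x X Y → Dec (Separated x X Y)
separated? x X Y = disjoint? (subsetSums X) (map (x +_) (subsetSums Y))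
  where
  -- The second list is an argument rather than a subterm of the predicate, so it is computed once.
  disjoint? : ∀ xs ys → Dec (All (_∉ ys) xs)
  disjoint? xs ys = all? (_∉? ys) xs

separated⇒∉subsetSums : ∀ {x} X Y → Separated x X Y → x ∉ subsetSums X
separated⇒∉subsetSums {x} X Y separated x∈ = All.lookup separated x∈
  (subst (_∈ map (x +_) (subsetSums Y)) (+-identityʳ x) (∈-map⁺ (x +_) (0∈subsetSums Y)))

views : {A : Set} → List A → List (A × List A)
views []       = []
views (x ∷ xs) = (x , xs) ∷ map (map₂ (x ∷_)) (views xs)

SumFree : List ℕ → Set
SumFree X = All (λ (x , rest) → x ∉ subsetSums rest) (views X)

sumFree? : ∀ X → Dec (SumFree X)
sumFree? X = all? (λ (x , rest) → x ∉? subsetSums rest) (views X)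

tuples : {A : Set} → List A → ℕ → List (List A)
tuples as zero    = [ [] ]
tuples as (suc d) = cartesianProductWith _∷_ as (tuples as d)

∈-tuples : {A : Set} {as xs : List A} → All (_∈ as) xs → xs ∈ tuples as (length xs)
∈-tuples []         = here refl
∈-tuples (x∈ ∷ xs∈) = ∈-cartesianProductWith⁺ _∷_ x∈ (∈-tuples xs∈)

labelsUpTo : ℕ → List ℕ
labelsUpTo = applyUpTo suc

∈-labelsUpTo : ∀ {k x} → 1 ≤ x → x ≤ k → x ∈ labelsUpTo k
∈-labelsUpTo {x = suc x} (s≤s z≤n) x≤k = ∈-applyUpTo⁺ suc x≤k

lookup-injective : {A : Set} {xs : List A} → Unique xs → ∀ i j → lookup xs i ≡ lookup xs j → i ≡ j
lookup-injective (_ ∷ _)   Fin.zero    Fin.zero    _  = refl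
lookup-injective (x∉ ∷ _)  Fin.zero    (Fin.suc j) eq = contradiction eq (All.lookup x∉ (∈-lookup j))
lookup-injective (x∉ ∷ _)  (Fin.suc i) Fin.zero    eq = contradiction (sym eq) (All.lookup x∉ (∈-lookup i))
lookup-injective (_ ∷ xs∉) (Fin.suc i) (Fin.suc j) eq = cong Fin.suc (lookup-injective xs∉ i j eq)

AllPairs-∈ : ∀ {A : Set} {R : A → A → Set} {xs x y} → (∀ {a b} → R a b → R b a) →
  AllPairs R xs → x ∈ xs → y ∈ xs → x ≢ y → R x y
AllPairs-∈ symmetric (_ ∷ _)   (here refl) (here refl) x≢y = contradiction refl x≢y
AllPairs-∈ symmetric (rx ∷ _)  (here refl) (there y∈)  _   = All.lookup rx y∈
AllPairs-∈ symmetric (rx ∷ _)  (there x∈)  (here refl) _   = symmetric (All.lookup rx x∈)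
AllPairs-∈ symmetric (_ ∷ rxs) (there x∈)  (there y∈)  x≢y = AllPairs-∈ symmetric rxs x∈ y∈ x≢y

AllPairs-within : ∀ {A : Set} {R S : A → A → Set} {xs} →
  (∀ {x y} → x ∈ xs → y ∈ xs → R x y → S x y) → AllPairs R xs → AllPairs S xs
AllPairs-within R⇒S []         = []
AllPairs-within R⇒S (rx ∷ rxs) =
  All.tabulate (λ y∈ → R⇒S (here refl) (there y∈) (All.lookup rx y∈)) ∷
  AllPairs-within (λ x∈ y∈ → R⇒S (there x∈) (there y∈)) rxs

module _ {A : Set} (_≟_ : DecidableEquality A) where

  remove : A → List A → List A
  remove x = filter (λ y → ¬? (y ≟ x))

  remove-∉ : ∀ {x xs} → All (x ≢_) xs → remove x xs ≡ xs
  remove-∉ x∉ = filter-all (λ y → ¬? (y ≟ _)) (All.map (_∘ sym) x∉)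

  remove-head : ∀ {x xs} → All (x ≢_) xs → remove x (x ∷ xs) ≡ xs
  remove-head x∉ = trans (filter-reject (λ y → ¬? (y ≟ _)) (λ x≢x → x≢x refl)) (remove-∉ x∉)

  remove-there : ∀ {x y} xs → y ≢ x → remove x (y ∷ xs) ≡ y ∷ remove x xs
  remove-there _ = filter-accept (λ z → ¬? (z ≟ _))

  views-map : ∀ {B : Set} (f : A → B) {xs} → Unique xs → views (map f xs) ≡ map (λ x → f x , map f (remove x xs)) xs
  views-map f []                = refl
  views-map f {x ∷ xs} (x∉ ∷ u) = cong₂ _∷_ (cong (λ ys → f x , map f ys) (sym (remove-head x∉))) (begin
      map (map₂ (f x ∷_)) (views (map f xs))
    ≡⟨ cong (map (map₂ (f x ∷_))) (views-map f u) ⟩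
      map (map₂ (f x ∷_)) (map (λ y → f y , map f (remove y xs)) xs)
    ≡⟨ map-∘ xs ⟨
      map (λ y → f y , f x ∷ map f (remove y xs)) xs
    ≡⟨ map-cong-local (All.map (λ {y} x≢y → cong (λ ys → f y , map f ys) (sym (remove-there xs x≢y))) x∉) ⟩
      map (λ y → f y , map f (remove y (x ∷ xs))) xs
    ∎)
    where open ≡-Reasoning

  sum-remove : ∀ (h : A → ℕ) {x xs} → Unique xs → x ∈ xs → sum (map h xs) ≡ h x + sum (map h (remove x xs))
  sum-remove h (x∉ ∷ _) (here refl) = cong (λ ys → h _ + sum (map h ys)) (sym (remove-head x∉))
  sum-remove h {x} {y ∷ xs} (y∉ ∷ u) (there x∈) = begin
      h y + sum (map h xs)
    ≡⟨ cong (h y +_) (sum-remove h u x∈) ⟩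
      h y + (h x + sum (map h (remove x xs)))
    ≡⟨ x∙yz≈y∙xz +-commutativeSemigroup (h y) (h x) _ ⟩
      h x + (h y + sum (map h (remove x xs)))
    ≡⟨ cong (λ ys → h x + sum (map h ys)) (remove-there xs (All.lookup y∉ x∈)) ⟨
      h x + sum (map h (remove x (y ∷ xs)))
    ∎
    where open ≡-Reasoning

  update : A → Bool → (A → Bool) → A → Bool
  update x b p y = if does (y ≟ x) then b else p y

  update-≡ : ∀ x b p → update x b p x ≡ b
  update-≡ x b p rewrite dec-true (x ≟ x) refl = refl

  update-≢ : ∀ {x y} b p → y ≢ x → update x b p y ≡ p y
  update-≢ {x} {y} b p y≢x rewrite dec-false (y ≟ x) y≢x = refl

  extendSelection : ∀ (f : A → ℕ) (q : A → Bool) b {x xs t} → All (x ≢_) xs →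
    ∃ (λ p → (∀ y → y ∉ xs → p y ≡ q y) × selectedSum p f xs ≡ t) →
    ∃ λ p → (∀ y → y ∉ x ∷ xs → p y ≡ q y) × selectedSum p f (x ∷ xs) ≡ (if b then f x else 0) + t
  extendSelection f q b {x} x∉ (p , outside , sum≡) =
    update x b p ,
    (λ y y∉ → trans (update-≢ b p (y∉ ∘ here)) (outside y (y∉ ∘ there))) ,
    cong₂ _+_ (cong (λ c → if c then f x else 0) (update-≡ x b p))
              (trans (selectedSum-cong (λ y∈ → update-≢ b p (All.lookup x∉ y∈ ∘ sym)) (λ _ → refl)) sum≡)

  subsetSums⇒selectedSum : ∀ (f : A → ℕ) {xs s} → Unique xs → s ∈ subsetSums (map f xs) → (q : A → Bool) →
    ∃ λ p → (∀ y → y ∉ xs → p y ≡ q y) × selectedSum p f xs ≡ s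
  subsetSums⇒selectedSum f [] (here refl) q = q , (λ _ _ → refl) , refl
  subsetSums⇒selectedSum f {x ∷ xs} (x∉ ∷ u) s∈ q with ∈-++⁻ (subsetSums (map f xs)) s∈
  ... | inj₁ s∈′ = extendSelection f q false x∉ (subsetSums⇒selectedSum f u s∈′ q)
  ... | inj₂ s∈″ with t , t∈ , refl ← ∈-map⁻ (f x +_) s∈″ =
    extendSelection f q true x∉ (subsetSums⇒selectedSum f u t∈ q)

-- Universal labelings are the edge-separated labelings

module _ (G : Graph) where

  Vertex : Set
  Vertex = Fin (n G)

  adjacent? : ∀ u → Decidable (Edge G u)
  adjacent? u w = adj G u w Bool.≟ true

  edge-sym : ∀ {u v} → Edge G u v → Edge G v u
  edge-sym {u} {v} uv = trans (adj-sym G v u) uv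

  edge⇒≢ : ∀ {u v} → Edge G u v → u ≢ v
  edge⇒≢ {u} uu refl with () ← trans (sym uu) (irrefl G u)

  neighbours : Vertex → List Vertex
  neighbours u = filter (adjacent? u) (allFin (n G))

  neighbours-unique : ∀ u → Unique (neighbours u)
  neighbours-unique u = Uniqueₚ.filter⁺ (adjacent? u) (Uniqueₚ.allFin⁺ (n G))

  ∈-neighbours⁺ : ∀ {u w} → Edge G u w → w ∈ neighbours u
  ∈-neighbours⁺ {u} {w} uw = ∈-filter⁺ (adjacent? u) (∈-allFin w) uw

  ∈-neighbours⁻ : ∀ {u w} → w ∈ neighbours u → Edge G u w
  ∈-neighbours⁻ {u} w∈ = proj₂ (∈-filter⁻ (adjacent? u) {xs = allFin (n G)} w∈)

  degree≡length : ∀ u → degree G u ≡ length (neighbours u)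
  degree≡length u = trans (selectedSum-filter (adj G u) (λ _ → 1) (allFin (n G))) (sum-ones (neighbours u))
    where
    sum-ones : (xs : List Vertex) → sum (map (λ _ → 1) xs) ≡ length xs
    sum-ones []       = refl
    sum-ones (_ ∷ xs) = cong suc (sum-ones xs)

  otherNeighbours : Vertex → Vertex → List Vertex
  otherNeighbours u v = remove Fin._≟_ v (neighbours u)

  otherNeighbours-unique : ∀ u v → Unique (otherNeighbours u v)
  otherNeighbours-unique u v = Uniqueₚ.filter⁺ _ (neighbours-unique u)

  ∈-otherNeighbours⁻ : ∀ {u v w} → w ∈ otherNeighbours u v → Edge G u w × w ≢ v
  ∈-otherNeighbours⁻ {v = v} w∈ =
    let w∈′ , w≢v = ∈-filter⁻ (λ w → ¬? (w Fin.≟ v)) w∈ in ∈-neighbours⁻ w∈′ , w≢v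

  labelsAt : (Vertex → Vertex → ℕ) → Vertex → List ℕ
  labelsAt ℓ u = map (ℓ u) (neighbours u)

  otherLabels : (Vertex → Vertex → ℕ) → Vertex → Vertex → List ℕ
  otherLabels ℓ u v = map (ℓ u) (otherNeighbours u v)

  views-labelsAt : ∀ ℓ u → views (labelsAt ℓ u) ≡ map (λ v → ℓ u v , otherLabels ℓ u v) (neighbours u)
  views-labelsAt ℓ u = views-map Fin._≟_ (ℓ u) (neighbours-unique u)

  ∈-views-labelsAt⁺ : ∀ ℓ {u v} → Edge G u v → (ℓ u v , otherLabels ℓ u v) ∈ views (labelsAt ℓ u)
  ∈-views-labelsAt⁺ ℓ {u} {v} uv = subst ((ℓ u v , otherLabels ℓ u v) ∈_) (sym (views-labelsAt ℓ u))
    (∈-map⁺ (λ w → ℓ u w , otherLabels ℓ u w) (∈-neighbours⁺ uv))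

  ∈-views-labelsAt⁻ : ∀ ℓ {u x X} → (x , X) ∈ views (labelsAt ℓ u) →
    ∃ λ v → Edge G u v × x ≡ ℓ u v × X ≡ otherLabels ℓ u v
  ∈-views-labelsAt⁻ ℓ {u} {x} {X} xX∈
    with v , v∈ , refl ← ∈-map⁻ (λ w → ℓ u w , otherLabels ℓ u w)
                                (subst ((x , X) ∈_) (views-labelsAt ℓ u) xX∈) =
    v , ∈-neighbours⁻ v∈ , refl , refl

  labelsAt∈tuples : ∀ {d} ℓ (as : List ℕ) → Regular d G → ∀ u → (∀ {w} → Edge G u w → ℓ u w ∈ as) →
    labelsAt ℓ u ∈ tuples as d
  labelsAt∈tuples ℓ as regular u labels∈ = subst (λ m → labelsAt ℓ u ∈ tuples as m)
    (trans (length-map (ℓ u) (neighbours u)) (trans (sym (degree≡length u)) (regular u)))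
    (∈-tuples (Allₚ.map⁺ (All.tabulate (labels∈ ∘ ∈-neighbours⁻))))

  inSum-split : ∀ {k ℓ o u v} → Labeling G k ℓ → Edge G u v →
    inSum G ℓ o u ≡ (if o v u then ℓ u v else 0) + selectedSum (λ w → o w u) (ℓ u) (otherNeighbours u v)
  inSum-split {ℓ = ℓ} {o} {u} {v} labeling uv = begin
      inSum G ℓ o u
    ≡⟨ selectedSum-cong {xs = allFin (n G)} (λ {w} _ → adj-sym G w u) (λ _ → refl) ⟩
      selectedSum (adj G u) into (allFin (n G))
    ≡⟨ selectedSum-filter (adj G u) into (allFin (n G)) ⟩
      sum (map into (neighbours u))
    ≡⟨ sum-remove Fin._≟_ into (neighbours-unique u) (∈-neighbours⁺ uv) ⟩
      into v + selectedSum (λ w → o w u) (λ w → ℓ w u) (otherNeighbours u v)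
    ≡⟨ cong₂ _+_ (cong (λ x → if o v u then x else 0) (symmetric uv))
                 (selectedSum-cong (λ _ → refl) (symmetric ∘ proj₁ ∘ ∈-otherNeighbours⁻)) ⟩
      (if o v u then ℓ u v else 0) + selectedSum (λ w → o w u) (ℓ u) (otherNeighbours u v)
    ∎
    where
    open ≡-Reasoning
    into : Vertex → ℕ
    into w = if o w u then ℓ w u else 0
    symmetric : ∀ {w} → Edge G u w → ℓ w u ≡ ℓ u w
    symmetric uw = sym (proj₁ (labeling u _ uw))

  Tournament : (Vertex → Vertex → Bool) → Set
  Tournament o = ∀ x y → x ≢ y → o y x ≡ not (o x y)

  tournament⇒orientation : ∀ {o} → Tournament o → Orientation G o
  tournament⇒orientation {o} tournament x y xy with o x y | tournament x y (edge⇒≢ xy)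
  ... | true  | oyx = inj₁ (refl , oyx)
  ... | false | oyx = inj₂ (refl , oyx)

  byIndex : Vertex → Vertex → Bool
  byIndex x y = does (x Fin.<? y)

  byIndex-tournament : Tournament byIndex
  byIndex-tournament x y x≢y with Fin.<-cmp x y
  ... | tri< x<y _ _ = trans (dec-false (y Fin.<? x) (Fin.<-asym x<y)) (cong not (sym (dec-true (x Fin.<? y) x<y)))
  ... | tri≈ _ x≡y _ = contradiction x≡y x≢y
  ... | tri> _ _ y<x = trans (dec-true (y Fin.<? x) y<x) (cong not (sym (dec-false (x Fin.<? y) (Fin.<-asym y<x))))

  redirectInto : Vertex → (Vertex → Bool) → (Vertex → Vertex → Bool) → Vertex → Vertex → Bool
  redirectInto u α o x y = if does (y Fin.≟ u) then α x else if does (x Fin.≟ u) then not (α y) else o x y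

  redirectInto-tournament : ∀ {o} u α → Tournament o → Tournament (redirectInto u α o)
  redirectInto-tournament u α tournament x y x≢y with x Fin.≟ u | y Fin.≟ u
  ... | yes refl | yes refl = contradiction refl x≢y
  ... | yes refl | no _     = sym (Bool.not-involutive _)
  ... | no _     | yes refl = refl
  ... | no _     | no _     = tournament x y x≢y

  redirectInto-into : ∀ u α o x → redirectInto u α o x u ≡ α x
  redirectInto-into u α o x rewrite dec-true (u Fin.≟ u) refl = refl

  redirectInto-from : ∀ {u y} α o → y ≢ u → redirectInto u α o u y ≡ not (α y)
  redirectInto-from {u} {y} α o y≢u rewrite dec-false (y Fin.≟ u) y≢u | dec-true (u Fin.≟ u) refl = refl

  redirectInto-away : ∀ {u x y} α o → x ≢ u → y ≢ u → redirectInto u α o x y ≡ o x y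
  redirectInto-away {u} {x} {y} α o x≢u y≢u rewrite dec-false (y Fin.≟ u) y≢u | dec-false (x Fin.≟ u) x≢u = refl

  edgeOrientation : Vertex → Vertex → (Vertex → Bool) → (Vertex → Bool) → Vertex → Vertex → Bool
  edgeOrientation u v α β = redirectInto v β (redirectInto u α byIndex)

  edgeOrientation-orientation : ∀ u v α β → Orientation G (edgeOrientation u v α β)
  edgeOrientation-orientation u v α β =
    tournament⇒orientation (redirectInto-tournament v β (redirectInto-tournament u α byIndex-tournament))

  module _ {k ℓ u v} (labeling : Labeling G k ℓ) (uv : Edge G u v) (α β : Vertex → Bool) (βu : β u ≡ true) where

    private
      o : Vertex → Vertex → Bool
      o = edgeOrientation u v α β
      open ≡-Reasoning

    edgeOrientation-inSum-tail : inSum G ℓ o u ≡ selectedSum α (ℓ u) (otherNeighbours u v)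
    edgeOrientation-inSum-tail = begin
        inSum G ℓ o u
      ≡⟨ inSum-split {o = o} labeling uv ⟩
        (if o v u then ℓ u v else 0) + selectedSum (λ w → o w u) (ℓ u) (otherNeighbours u v)
      ≡⟨ cong₂ _+_ (cong (λ b → if b then ℓ u v else 0) v↛u) (selectedSum-cong w→u (λ _ → refl)) ⟩
        selectedSum α (ℓ u) (otherNeighbours u v)
      ∎
      where
      v↛u : o v u ≡ false
      v↛u = trans (redirectInto-from β (redirectInto u α byIndex) (edge⇒≢ uv)) (cong not βu)
      w→u : ∀ {w} → w ∈ otherNeighbours u v → o w u ≡ α w
      w→u w∈ = trans (redirectInto-away β (redirectInto u α byIndex)
                                        (proj₂ (∈-otherNeighbours⁻ w∈)) (edge⇒≢ uv))
                     (redirectInto-into u α byIndex _)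

    edgeOrientation-inSum-head : inSum G ℓ o v ≡ ℓ u v + selectedSum β (ℓ v) (otherNeighbours v u)
    edgeOrientation-inSum-head = begin
        inSum G ℓ o v
      ≡⟨ inSum-split {o = o} labeling (edge-sym uv) ⟩
        (if o u v then ℓ v u else 0) + selectedSum (λ w → o w v) (ℓ v) (otherNeighbours v u)
      ≡⟨ cong₂ _+_ (cong (λ b → if b then ℓ v u else 0) (trans (w→v u) βu))
                   (selectedSum-cong {xs = otherNeighbours v u} (λ {w} _ → w→v w) (λ _ → refl)) ⟩
        ℓ v u + selectedSum β (ℓ v) (otherNeighbours v u)
      ≡⟨ cong (_+ selectedSum β (ℓ v) (otherNeighbours v u)) (sym (proj₁ (labeling u v uv))) ⟩
        ℓ u v + selectedSum β (ℓ v) (otherNeighbours v u)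
      ∎
      where
      w→v : ∀ w → o w v ≡ β w
      w→v = redirectInto-into v β (redirectInto u α byIndex)

  EdgeSeparated : (Vertex → Vertex → ℕ) → Set
  EdgeSeparated ℓ = ∀ u v → Edge G u v → Separated (ℓ u v) (otherLabels ℓ u v) (otherLabels ℓ v u)

  universal⇒separated : ∀ {k ℓ} → UniversalLabeling G k ℓ → EdgeSeparated ℓ
  universal⇒separated {ℓ = ℓ} (labeling , universal) u v uv = All.tabulate collision
    where
    collision : ∀ {s} → s ∈ subsetSums (otherLabels ℓ u v) → s ∉ map (ℓ u v +_) (subsetSums (otherLabels ℓ v u))
    collision s∈ s∈′ with t , t∈ , refl ← ∈-map⁻ (ℓ u v +_) s∈′ =
      let α , _ , α-sum = subsetSums⇒selectedSum Fin._≟_ (ℓ u) (otherNeighbours-unique u v) s∈ (λ _ → false)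
          β , β-outside , β-sum = subsetSums⇒selectedSum Fin._≟_ (ℓ v) (otherNeighbours-unique v u) t∈ (λ _ → true)
          βu = β-outside u (λ u∈ → proj₂ (∈-otherNeighbours⁻ u∈) refl)
      in universal (edgeOrientation u v α β) (edgeOrientation-orientation u v α β) u v uv (begin
          inSum G ℓ (edgeOrientation u v α β) u
        ≡⟨ edgeOrientation-inSum-tail labeling uv α β βu ⟩
          selectedSum α (ℓ u) (otherNeighbours u v)
        ≡⟨ α-sum ⟩
          ℓ u v + t
        ≡⟨ cong (ℓ u v +_) β-sum ⟨
          ℓ u v + selectedSum β (ℓ v) (otherNeighbours v u)
        ≡⟨ edgeOrientation-inSum-head labeling uv α β βu ⟨
          inSum G ℓ (edgeOrientation u v α β) v
        ∎)
      where open ≡-Reasoning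

  separated⇒universal : ∀ {k ℓ} → Labeling G k ℓ → EdgeSeparated ℓ → UniversalLabeling G k ℓ
  separated⇒universal {ℓ = ℓ} labeling separated = labeling , distinct
    where
    orientedDistinct : ∀ {o u v} → Edge G u v → o u v ≡ true → o v u ≡ false → inSum G ℓ o u ≢ inSum G ℓ o v
    orientedDistinct {o} {u} {v} uv u→v v↛u eq =
      All.lookup (separated u v uv) (selectedSum∈subsetSums (λ w → o w u) (ℓ u) (otherNeighbours u v))
        (subst (_∈ map (ℓ u v +_) (subsetSums (otherLabels ℓ v u))) (sym tail≡head)
          (∈-map⁺ (ℓ u v +_) (selectedSum∈subsetSums (λ w → o w v) (ℓ v) (otherNeighbours v u))))
      where
      open ≡-Reasoning
      tail≡head : selectedSum (λ w → o w u) (ℓ u) (otherNeighbours u v) ≡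
                  ℓ u v + selectedSum (λ w → o w v) (ℓ v) (otherNeighbours v u)
      tail≡head = begin
          selectedSum (λ w → o w u) (ℓ u) (otherNeighbours u v)
        ≡⟨ cong (λ b → (if b then ℓ u v else 0) + selectedSum (λ w → o w u) (ℓ u) (otherNeighbours u v)) v↛u ⟨
          (if o v u then ℓ u v else 0) + selectedSum (λ w → o w u) (ℓ u) (otherNeighbours u v)
        ≡⟨ trans (sym (inSum-split {o = o} labeling uv)) (trans eq (inSum-split {o = o} labeling (edge-sym uv))) ⟩
          (if o u v then ℓ v u else 0) + selectedSum (λ w → o w v) (ℓ v) (otherNeighbours v u)
        ≡⟨ cong₂ (λ b x → (if b then x else 0) + selectedSum (λ w → o w v) (ℓ v) (otherNeighbours v u))
                 u→v (sym (proj₁ (labeling u v uv))) ⟩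
          ℓ u v + selectedSum (λ w → o w v) (ℓ v) (otherNeighbours v u)
        ∎

    distinct : ∀ o → Orientation G o → ∀ u v → Edge G u v → inSum G ℓ o u ≢ inSum G ℓ o v
    distinct o orientation u v uv with orientation u v uv
    ... | inj₁ (u→v , v↛u) = orientedDistinct uv u→v v↛u
    ... | inj₂ (u↛v , v→u) = orientedDistinct (edge-sym uv) v→u u↛v ∘ sym

  universal⇒sumFree : ∀ {k ℓ} → UniversalLabeling G k ℓ → ∀ u → SumFree (labelsAt ℓ u)
  universal⇒sumFree {ℓ = ℓ} universal u =
    subst (All (λ (x , rest) → x ∉ subsetSums rest)) (sym (views-labelsAt ℓ u))
      (Allₚ.map⁺ (All.tabulate λ {v} v∈ → separated⇒∉subsetSums (otherLabels ℓ u v) (otherLabels ℓ v u)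
        (universal⇒separated universal u v (∈-neighbours⁻ v∈))))

  colours≥degree : ∀ {j} → EdgeColorable G j → ∀ u → degree G u ≤ j
  colours≥degree {j} (c , _ , proper) u = subst (_≤ j) (sym (degree≡length u)) (Fin.injective⇒≤ injective)
    where
    colourAt : Fin (length (neighbours u)) → Fin j
    colourAt i = c u (lookup (neighbours u) i)
    injective : ∀ {i i′} → colourAt i ≡ colourAt i′ → i ≡ i′
    injective {i} {i′} eq with lookup (neighbours u) i Fin.≟ lookup (neighbours u) i′
    ... | yes same  = lookup-injective (neighbours-unique u) i i′ same
    ... | no differ =
      contradiction eq (proper u _ _ (∈-neighbours⁻ (∈-lookup i)) (∈-neighbours⁻ (∈-lookup i′)) differ)

-- Finite certificates

Rainbow : ∀ {d} → (ℕ → Fin d) → List ℕ → Set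
Rainbow colour = AllPairs (λ x y → colour x ≢ colour y)

sumFreeTuples : ℕ → ℕ → List (List ℕ)
sumFreeTuples K d = filter sumFree? (tuples (labelsUpTo K) d)

Unshareable : List (List ℕ) → ℕ × List ℕ → Set
Unshareable L (x , X) = All (λ Y → All (λ (y , Y′) → x ≡ y → ¬ Separated x X Y′) (views Y)) L

LowerCertificate : (d K : ℕ) → (ℕ → Fin d) → Set
LowerCertificate d K colour =
  All (λ X → (Rainbow colour X × K ∈ X) ⊎ Any (Unshareable (sumFreeTuples K d)) (views X)) (sumFreeTuples K d)

lowerCertificate? : ∀ d K colour → Dec (LowerCertificate d K colour)
lowerCertificate? d K colour = certify (sumFreeTuples K d)
  where
  unshareable? : ∀ L xX → Dec (Unshareable L xX)
  unshareable? L (x , X) = all? (λ Y → all? (λ (y , Y′) → (x ≟ℕ y) →-dec ¬? (separated? x X Y′)) (views Y)) L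
  -- Taking the list of tuples as an argument lets it be computed once instead of once per tuple.
  certify : ∀ L → Dec (All (λ X → (Rainbow colour X × K ∈ X) ⊎ Any (Unshareable L) (views X)) L)
  certify L = all? (λ X → (allPairs? (λ x y → ¬? (colour x Fin.≟ colour y)) X ×-dec K ∈? X)
                          ⊎-dec any? (unshareable? L) (views X)) L

SeparatedAtSharedLabels : List ℕ → List ℕ → Set
SeparatedAtSharedLabels X Y =
  All (λ (x , X′) → All (λ (y , Y′) → x ≡ y → Separated x X′ Y′) (views Y)) (views X)

paletteTuples : (d : ℕ) → (Fin d → ℕ) → List (List ℕ)
paletteTuples d palette = filter unique? (tuples (map palette (allFin d)) d)

UpperCertificate : (d : ℕ) → (Fin d → ℕ) → Set
UpperCertificate d palette = All (λ X → All (SeparatedAtSharedLabels X) P) P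
  where
  P : List (List ℕ)
  P = paletteTuples d palette

upperCertificate? : ∀ d palette → Dec (UpperCertificate d palette)
upperCertificate? d palette = all? (λ X → all? (separatedAtSharedLabels? X) P) P
  where
  P : List (List ℕ)
  P = paletteTuples d palette
  separatedAtSharedLabels? : ∀ X Y → Dec (SeparatedAtSharedLabels X Y)
  separatedAtSharedLabels? X Y =
    all? (λ (x , X′) → all? (λ (y , Y′) → (x ≟ℕ y) →-dec separated? x X′ Y′) (views Y)) (views X)

record Certificate (d K : ℕ) : Set where
  field
    colour            : ℕ → Fin d
    palette           : Fin d → ℕ
    palette-injective : ∀ i j → palette i ≡ palette j → i ≡ j
    palette-range     : ∀ i → 1 ≤ palette i × palette i ≤ K
    lower             : LowerCertificate d K colour
    upper             : UpperCertificate d palette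

module _ {d K : ℕ} (G : Graph) (regular : Regular d G) where

  labeling-mono : ∀ {j ℓ} → j ≤ K → Labeling G j ℓ → Labeling G K ℓ
  labeling-mono j≤K labeling u v uv = let ℓ≡ , 1≤ , ≤j = labeling u v uv in ℓ≡ , 1≤ , ≤-trans ≤j j≤K

  labelsAt∈sumFreeTuples : ∀ {ℓ} → UniversalLabeling G K ℓ → ∀ u → labelsAt G ℓ u ∈ sumFreeTuples K d
  labelsAt∈sumFreeTuples {ℓ} universal@(labeling , _) u =
    ∈-filter⁺ sumFree? (labelsAt∈tuples G ℓ (labelsUpTo K) regular u inRange) (universal⇒sumFree G universal u)
    where
    inRange : ∀ {w} → Edge G u w → ℓ u w ∈ labelsUpTo K
    inRange uw = let _ , 1≤ , ≤K = labeling u _ uw in ∈-labelsUpTo 1≤ ≤K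

  universal⇒rainbow : ∀ {colour ℓ} → LowerCertificate d K colour → UniversalLabeling G K ℓ → ∀ u →
    Rainbow colour (labelsAt G ℓ u) × K ∈ labelsAt G ℓ u
  universal⇒rainbow {ℓ = ℓ} lower universal u with All.lookup lower (labelsAt∈sumFreeTuples universal u)
  ... | inj₁ rainbow = rainbow
  ... | inj₂ unshareable with find unshareable
  ... | _ , xX∈ , unshared with ∈-views-labelsAt⁻ G ℓ xX∈
  ... | v , uv , refl , refl = contradiction (universal⇒separated G universal u v uv)
    (All.lookup (All.lookup unshared (labelsAt∈sumFreeTuples universal v))
      (∈-views-labelsAt⁺ G ℓ (edge-sym G uv)) (proj₁ (proj₁ universal u v uv)))

  universal⇒colourable : ∀ {colour ℓ} → LowerCertificate d K colour → UniversalLabeling G K ℓ → EdgeColorable G d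
  universal⇒colourable {colour} {ℓ} lower universal@(labeling , _) =
    (λ u w → colour (ℓ u w)) ,
    (λ u v uv → cong colour (proj₁ (labeling u v uv))) ,
    λ u v w uv uw → AllPairs-∈ (_∘ sym) (AllPairsₚ.map⁻ (proj₁ (universal⇒rainbow lower universal u)))
                      (∈-neighbours⁺ G uv) (∈-neighbours⁺ G uw)

  hasUniversalLabeling⇒K≤ : ∀ {colour} → LowerCertificate d K colour → Vertex G →
    ∀ j → HasUniversalLabeling G j → K ≤ j
  hasUniversalLabeling⇒K≤ lower u j (ℓ , labeling , universal) with K ≤? j
  ... | yes K≤j = K≤j
  ... | no K≰j =
    let universalK = labeling-mono (≰⇒≥ K≰j) labeling , universal
        v , v∈ , K≡ = ∈-map⁻ (ℓ u) (proj₂ (universal⇒rainbow lower universalK u))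
    in subst (_≤ j) (sym K≡) (proj₂ (proj₂ (labeling u v (∈-neighbours⁻ G v∈))))

  colourable⇒universal : (C : Certificate d K) (c : Vertex G → Vertex G → Fin d) → ProperEdgeColoring G d c →
    UniversalLabeling G K (λ u w → Certificate.palette C (c u w))
  colourable⇒universal C c (symmetric , proper) = separated⇒universal G labeling λ u v uv →
    All.lookup (All.lookup (All.lookup (All.lookup upper (palette∈ u)) (palette∈ v))
      (∈-views-labelsAt⁺ G ℓ uv)) (∈-views-labelsAt⁺ G ℓ (edge-sym G uv)) (proj₁ (labeling u v uv))
    where
    open Certificate C
    ℓ : Vertex G → Vertex G → ℕ
    ℓ u w = palette (c u w)
    labeling : Labeling G K ℓ
    labeling u v uv = cong palette (symmetric u v uv) , palette-range (c u v)
    palette∈ : ∀ u → labelsAt G ℓ u ∈ paletteTuples d palette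
    palette∈ u = ∈-filter⁺ unique?
      (labelsAt∈tuples G ℓ (map palette (allFin d)) regular u (λ _ → ∈-map⁺ palette (∈-allFin _)))
      (AllPairsₚ.map⁺ (AllPairs-within
        (λ v∈ w∈ v≢w → proper u _ _ (∈-neighbours⁻ G v∈) (∈-neighbours⁻ G w∈) v≢w ∘ palette-injective _ _)
        (neighbours-unique G u)))

inhabited? : ∀ m → Dec (Fin m)
inhabited? zero    = no λ ()
inhabited? (suc m) = yes Fin.zero

univLabelingNumber⇔class1 : ∀ {d K} → Certificate d K → .{{NonZero K}} →
  ∀ G → Regular d G → (UnivLabelingNumber G K ⇔ Class1 G)
univLabelingNumber⇔class1 {d} {K} C G regular = mk⇔ toClass1 fromClass1
  where
  open Certificate C

  toClass1 : UnivLabelingNumber G K → Class1 G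
  toClass1 ((ℓ , universal) , minimal) with inhabited? (n G)
  ... | yes u = d , ((u , regular u) , ≤-reflexive ∘ regular) ,
                universal⇒colourable G regular lower universal ,
                λ j c → subst (_≤ j) (regular u) (colours≥degree G c u)
  ... | no noVertex = contradiction (≤-trans (>-nonZero⁻¹ K) (minimal 0 edgeless)) λ ()
    where
    edgeless : HasUniversalLabeling G 0
    edgeless = (λ _ _ → 0) , (λ u → contradiction u noVertex) , λ _ _ u → contradiction u noVertex

  fromClass1 : Class1 G → UnivLabelingNumber G K
  fromClass1 (d′ , ((u , d′≡) , _) , colourable , _) =
    let c , proper = subst (EdgeColorable G) (trans (sym d′≡) (regular u)) colourable
    in (_ , colourable⇒universal G regular C c proper) , hasUniversalLabeling⇒K≤ G regular lower u

-- The certificates for cubic and quartic graphs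

injective? : ∀ {d} (g : Fin d → ℕ) → Dec (∀ i j → g i ≡ g j → i ≡ j)
injective? g = Fin.all? λ i → Fin.all? λ j → (g i ≟ℕ g j) →-dec (i Fin.≟ j)

inRange? : ∀ {d} K (g : Fin d → ℕ) → Dec (∀ i → 1 ≤ g i × g i ≤ K)
inRange? K g = Fin.all? λ i → (1 ≤? g i) ×-dec (g i ≤? K)

-- The sum-free triples of labels ≤ 4 are the orderings of {1,2,4} and {2,3,4}.
colour₃ : ℕ → Fin 3
colour₃ 2 = Fin.suc Fin.zero
colour₃ 4 = Fin.suc (Fin.suc Fin.zero)
colour₃ _ = Fin.zero

palette₃ : Fin 3 → ℕ
palette₃ Fin.zero              = 1
palette₃ (Fin.suc Fin.zero)    = 2
palette₃ (Fin.suc (Fin.suc _)) = 4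

cubic : Certificate 3 4
Certificate.colour            cubic = colour₃
Certificate.palette           cubic = palette₃
Certificate.palette-injective cubic = from-yes (injective? palette₃)
Certificate.palette-range     cubic = from-yes (inRange? 4 palette₃)
Certificate.lower             cubic = from-yes (lowerCertificate? 3 4 colour₃)
Certificate.upper             cubic = from-yes (upperCertificate? 3 palette₃)

-- The sum-free quadruples of labels ≤ 7 are the orderings of {3,5,6,7} and {4,5,6,7}, which are
-- rainbow, and of {1,3,5,7}, {2,3,6,7} and {3,4,5,6}, which are unshareable.
colour₄ : ℕ → Fin 4
colour₄ 5 = Fin.suc Fin.zero
colour₄ 6 = Fin.suc (Fin.suc Fin.zero)
colour₄ 7 = Fin.suc (Fin.suc (Fin.suc Fin.zero))
colour₄ _ = Fin.zero

palette₄ : Fin 4 → ℕ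
palette₄ Fin.zero                        = 3
palette₄ (Fin.suc Fin.zero)              = 5
palette₄ (Fin.suc (Fin.suc Fin.zero))    = 6
palette₄ (Fin.suc (Fin.suc (Fin.suc _))) = 7

quartic : Certificate 4 7
Certificate.colour            quartic = colour₄
Certificate.palette           quartic = palette₄
Certificate.palette-injective quartic = from-yes (injective? palette₄)
Certificate.palette-range     quartic = from-yes (inRange? 7 palette₄)
Certificate.lower             quartic = from-yes (lowerCertificate? 4 7 colour₄)
Certificate.upper             quartic = from-yes (upperCertificate? 4 palette₄)

mainTheorem3 :
    (∀ (G : Graph) → Regular 3 G → (UnivLabelingNumber G 4 ⇔ Class1 G)) ×
    (∀ (G : Graph) → Regular 4 G → (UnivLabelingNumber G 7 ⇔ Class1 G))
mainTheorem3 = univLabelingNumber⇔class1 cubic , univLabelingNumber⇔class1 quartic
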